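{- Let $D$ be a D-graph and let $x,v_1,v_2$ be vertices of $D$. If $v_1\prec x$, $v_2\prec x$ and $v_1\ne v_2$, then $v_2\prec v_1$ or $v_1\prec v_2$.
   Context: A graph is a pair of functions $W,E\colon A\to V$ with $A\cap V=\emptyset$. A vertex $v$ is a $W$-vertex if no edge $a$ has $E(a)=v$, an $E$-vertex if no edge has $W(a)=v$, inner if neither. An edge $a$ is a $W$-edge ($E$-edge) if $W(a)$ is a $W$-vertex ($E(a)$ an $E$-vertex). $W$-$E$-functional: every $W$-edge $a$ has $W(a)\ne W(b)$ for $b\ne a$ and every $E$-edge $a$ has $E(a)\neq E(b)$ for $b\ne a$. A semipath from $v_0$ to $v_n$ is $v_0a_1v_1\dots a_nv_n$ ($n\ge0$) with $\{W(a_i),E(a_i)\}=\{v_{i-1},v_i\}$ and no repeated vertex; weakly connected: any two distinct vertices joined by a semipath; acyclic: no directed closed walk $v_0a_1\dots a_nv_n$, $n\ge1$, $W(a_i)=v_{i-1}$, $E(a_i)=v_i$, vertices distinct except $v_0=v_n$. A D-graph is a finite, acyclic, $W$-$E$-functional, weakly connected graph with an inner vertex. For a vertex $x$, $[x]_W$ is the set of semipaths from $x$ to some $W$-vertex; $v\prec x$ means $v\ne x$ and $v$ occurs in every semipath in $[x]_W$. -}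

module Defs where

open import Data.Nat using (ℕ)
open import Data.Fin using (Fin)
open import Data.List using (List; []; _∷_)
open import Data.List.Membership.Propositional using (_∈_)
open import Data.List.Relation.Unary.Unique.Propositional using (Unique)
open import Data.Product using (Σ; ∃; _×_; _,_)
open import Data.Sum using (_⊎_)
open import Relation.Nullary using (¬_)
open import Relation.Binary.PropositionalEquality using (_≡_; _≢_)

record Graph : Set where
  field
    nA nV : ℕ
    W E   : Fin nA → Fin nV

module _ (G : Graph) where
  open Graph G

  Edge   = Fin nA
  Vertex = Fin nV

  IsWVertex : Vertex → Set
  IsWVertex v = ∀ (a : Edge) → E a ≢ v

  IsEVertex : Vertex → Set
  IsEVertex v = ∀ (a : Edge) → W a ≢ v

  IsInner : Vertex → Set
  IsInner v = ¬ IsWVertex v × ¬ IsEVertex v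

  IsWEdge : Edge → Set
  IsWEdge a = IsWVertex (W a)

  IsEEdge : Edge → Set
  IsEEdge a = IsEVertex (E a)

  WEFunctional : Set
  WEFunctional =
    (∀ a → IsWEdge a → ∀ b → b ≢ a → W a ≢ W b) ×
    (∀ a → IsEEdge a → ∀ b → b ≢ a → E a ≢ E b)

  Link : Edge → Vertex → Vertex → Set
  Link a u v = (W a ≡ u × E a ≡ v) ⊎ (W a ≡ v × E a ≡ u)

  data SWalk : Vertex → Vertex → Set where
    nil  : ∀ v → SWalk v v
    cons : ∀ {u v w} (a : Edge) → Link a u v → SWalk v w → SWalk u w

  sverts : ∀ {u w} → SWalk u w → List Vertex
  sverts (nil v) = v ∷ []
  sverts (cons {u} a _ p) = u ∷ sverts p

  Semipath : Vertex → Vertex → Set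
  Semipath u w = Σ (SWalk u w) (λ p → Unique (sverts p))

  data DWalk : Vertex → Vertex → Set where
    nil  : ∀ v → DWalk v v
    cons : ∀ {u v w} (a : Edge) → W a ≡ u → E a ≡ v → DWalk v w → DWalk u w

  dverts : ∀ {u w} → DWalk u w → List Vertex
  dverts (nil v) = v ∷ []
  dverts (cons {u} a _ _ p) = u ∷ dverts p

  -- acyclic: no directed closed walk v₀ a₁ v₁ … aₙ vₙ (n ≥ 1) with v₀ = vₙ and
  -- v₁,…,vₙ distinct. Such a cycle is a first edge a : v₀ → v₁ followed by a
  -- directed walk v₁ → v₀ whose vertex list v₁ … vₙ is repetition-free.
  Acyclic : Set
  Acyclic = ∀ (v₀ v₁ : Vertex) (a : Edge) → W a ≡ v₀ → E a ≡ v₁ →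
            (p : DWalk v₁ v₀) → ¬ Unique (dverts p)

  WeaklyConnected : Set
  WeaklyConnected = ∀ (u v : Vertex) → u ≢ v → Semipath u v

  -- D-graph (finiteness is built into Graph)
  IsDGraph : Set
  IsDGraph = Acyclic × WEFunctional × WeaklyConnected × ∃ IsInner

  _≺_ : Vertex → Vertex → Set
  v ≺ x = v ≢ x × (∀ (w : Vertex) → IsWVertex w → (p : Semipath x w) →
                     v ∈ sverts (Σ.proj₁ p))

-- Take a semipath p from x to a W-vertex. Both v₁ and v₂ lie on p; say v₁ comes
-- first, so the initial segment q of p from x to v₁ avoids v₂. For any semipath r
-- from v₁ to a W-vertex, the walk q r shortens to a semipath from x to that
-- W-vertex using only vertices of q and r; it passes through v₂ since v₂ ≺ x, and
-- v₂ is not on q, hence v₂ is on r. So v₂ ≺ v₁.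
module Submission where

open import Defs
open import Data.Empty using (⊥-elim)
open import Data.Fin.Properties using (_≟_; all?; any?)
open import Data.List using (List; _∷_)
open import Data.List.Membership.Propositional using (_∈_; _∉_)
import Data.List.Membership.DecPropositional as DecMembership
open import Data.List.Relation.Binary.Subset.Propositional using (_⊆_)
import Data.List.Relation.Unary.All as All
open import Data.List.Relation.Unary.All.Properties using (¬Any⇒All¬)
open import Data.List.Relation.Unary.Any using (here; there)
open import Data.List.Relation.Unary.Unique.Propositional using (Unique; []; _∷_)
open import Data.Product using (Σ-syntax; ∃; _×_; _,_; proj₁; proj₂)
open import Data.Sum using (_⊎_; inj₁; inj₂; [_,_])
open import Function using (_∘_; id)
open import Relation.Binary.PropositionalEquality using (_≢_; refl; sym)
open import Relation.Nullary using (¬_; Dec; yes; no; ¬?)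

∉-∷⁺ : ∀ {A : Set} {x v : A} {vs : List A} → x ≢ v → v ∉ vs → v ∉ x ∷ vs
∉-∷⁺ x≢v _    (here v≡x)   = x≢v (sym v≡x)
∉-∷⁺ _   v∉vs (there v∈vs) = v∉vs v∈vs

module _ (G : Graph) where
  open DecMembership (_≟_ {Graph.nV G}) using (_∈?_)

  _++ʷ_ : ∀ {u v w} → SWalk G u v → SWalk G v w → SWalk G u w
  nil _      ++ʷ q = q
  cons a l p ++ʷ q = cons a l (p ++ʷ q)

  ∈-++ʷ⁻ : ∀ {u v w z} (p : SWalk G u v) (q : SWalk G v w) →
           z ∈ sverts G (p ++ʷ q) → z ∈ sverts G p ⊎ z ∈ sverts G q
  ∈-++ʷ⁻ (nil _)      q z∈q          = inj₂ z∈q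
  ∈-++ʷ⁻ (cons a l p) q (here z≡u)   = inj₁ (here z≡u)
  ∈-++ʷ⁻ (cons a l p) q (there z∈pq) = [ inj₁ ∘ there , inj₂ ] (∈-++ʷ⁻ p q z∈pq)

  SemipathWithin : List (Vertex G) → Vertex G → Vertex G → Set
  SemipathWithin vs u w = Σ[ q ∈ SWalk G u w ] Unique (sverts G q) × sverts G q ⊆ vs

  suffix-of-semipath : ∀ {u v w} (p : SWalk G u w) → Unique (sverts G p) →
                       v ∈ sverts G p → SemipathWithin (sverts G p) v w
  suffix-of-semipath (nil _)      p-unique        (here refl) = nil _ , p-unique , id
  suffix-of-semipath (cons a l p) p-unique        (here refl) = cons a l p , p-unique , id
  suffix-of-semipath (cons a l p) (_ ∷ p-unique) (there v∈p)
    with q , q-unique , q⊆p ← suffix-of-semipath p p-unique v∈p =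
    q , q-unique , there ∘ q⊆p

  -- Cut out the closed detour at the first vertex that recurs later.
  walk⇒semipath : ∀ {u w} (p : SWalk G u w) → SemipathWithin (sverts G p) u w
  walk⇒semipath (nil v) = nil v , All.[] ∷ [] , id
  walk⇒semipath {u} (cons a l p)
    with p′ , p′-unique , p′⊆p ← walk⇒semipath p
    with u ∈? sverts G p′
  ... | yes u∈p′ =
    let q , q-unique , q⊆p′ = suffix-of-semipath p′ p′-unique u∈p′
    in q , q-unique , there ∘ p′⊆p ∘ q⊆p′
  ... | no u∉p′ =
    cons a l p′ , ¬Any⇒All¬ _ u∉p′ ∷ p′-unique ,
    λ { (here z≡u) → here z≡u ; (there z∈p′) → there (p′⊆p z∈p′) }

  reach-one-avoiding-other : ∀ {x w v₁ v₂} (p : SWalk G x w) → Unique (sverts G p) →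
    v₁ ∈ sverts G p → v₂ ∈ sverts G p → v₁ ≢ v₂ →
    (Σ[ q ∈ SWalk G x v₁ ] v₂ ∉ sverts G q) ⊎ (Σ[ q ∈ SWalk G x v₂ ] v₁ ∉ sverts G q)
  reach-one-avoiding-other (nil _) _ (here refl) (here refl) v₁≢v₂ = ⊥-elim (v₁≢v₂ refl)
  reach-one-avoiding-other (cons _ _ _) _ (here refl) _ v₁≢v₂ =
    inj₁ (nil _ , ∉-∷⁺ v₁≢v₂ λ ())
  reach-one-avoiding-other (cons _ _ _) _ (there _) (here refl) v₁≢v₂ =
    inj₂ (nil _ , ∉-∷⁺ (v₁≢v₂ ∘ sym) λ ())
  reach-one-avoiding-other (cons a l p) (x∉p ∷ p-unique) (there v₁∈p) (there v₂∈p) v₁≢v₂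
    with reach-one-avoiding-other p p-unique v₁∈p v₂∈p v₁≢v₂
  ... | inj₁ (q , v₂∉q) = inj₁ (cons a l q , ∉-∷⁺ (All.lookup x∉p v₂∈p) v₂∉q)
  ... | inj₂ (q , v₁∉q) = inj₂ (cons a l q , ∉-∷⁺ (All.lookup x∉p v₁∈p) v₁∉q)

  ≺-from-avoiding-walk : ∀ {x v u} (q : SWalk G x v) → u ∉ sverts G q →
                         _≺_ G u x → u ≢ v → _≺_ G u v
  ≺-from-avoiding-walk {v = v} {u} q u∉q (_ , u-on-every-path) u≢v = u≢v , u-on-r
    where
    u-on-r : ∀ w → IsWVertex G w → (r : Semipath G v w) → u ∈ sverts G (proj₁ r)
    u-on-r w w-W (r , _) with qr , qr-unique , qr⊆q++r ← walk⇒semipath (q ++ʷ r) =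
      [ ⊥-elim ∘ u∉q , id ] (∈-++ʷ⁻ q r (qr⊆q++r (u-on-every-path w w-W (qr , qr-unique))))

  ≺-without-W-vertices : ¬ ∃ (IsWVertex G) → ∀ {u v} → u ≢ v → _≺_ G u v
  ≺-without-W-vertices ∄W u≢v = u≢v , λ w w-W _ → ⊥-elim (∄W (w , w-W))

  W-vertex? : Dec (∃ (IsWVertex G))
  W-vertex? = any? λ v → all? λ a → ¬? (Graph.E G a ≟ v)

  connected⇒semipath : WeaklyConnected G → ∀ u v → Semipath G u v
  connected⇒semipath connected u v with u ≟ v
  ... | yes refl = nil v , All.[] ∷ []
  ... | no u≢v   = connected u v u≢v

lemma3p2p1 : (G : Graph) → IsDGraph G →
    (x v₁ v₂ : Vertex G) → _≺_ G v₁ x → _≺_ G v₂ x → v₁ ≢ v₂ →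
    _≺_ G v₂ v₁ ⊎ _≺_ G v₁ v₂
lemma3p2p1 G (_ , _ , connected , _) x v₁ v₂ v₁≺x v₂≺x v₁≢v₂ with W-vertex? G
... | no ∄W = inj₁ (≺-without-W-vertices G ∄W (v₁≢v₂ ∘ sym))
... | yes (w , w-W)
  with p , p-unique ← connected⇒semipath G connected x w
  with reach-one-avoiding-other G p p-unique
         (proj₂ v₁≺x w w-W (p , p-unique)) (proj₂ v₂≺x w w-W (p , p-unique)) v₁≢v₂
... | inj₁ (q , v₂∉q) = inj₁ (≺-from-avoiding-walk G q v₂∉q v₂≺x (v₁≢v₂ ∘ sym))
... | inj₂ (q , v₁∉q) = inj₂ (≺-from-avoiding-walk G q v₁∉q v₁≺x v₁≢v₂)
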